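{- Every dense subset of $\mathcal{M}$ (in the mutation class topology) is infinite.
   Context: A quiver is a finite directed multigraph (with at least one vertex) without loops and without oriented 2-cycles, with vertices labeled $1,\dots,n$. For a vertex $k$, the mutation $\mu_k(Q)$ is obtained by: (1) for each oriented path $i\to k\to j$ adding an arrow $i\to j$; (2) reversing all arrows incident to $k$; (3) removing a maximal collection of pairwise-disjoint oriented 2-cycles created. Two quivers are mutation-equivalent if one is isomorphic to a quiver obtained from the other by a finite sequence of mutations; the mutation class $[Q]$ is the equivalence class of $Q$. For $I\subseteq[n]$, the full subquiver $Q_I$ has vertex set $I$ and all arrows of $Q$ between vertices of $I$. A mutation class $[P]$ embeds into $[Q]$, written $[P]\preceq[Q]$, if some $P'\in[P]$ is isomorphic to a full subquiver of some $Q'\in[Q]$; this is a partial order on the set $\mathcal{M}$ of all mutation classes. The mutation class topology on $\mathcal{M}$ is the Alexandrov topology of $\preceq$: closed sets are the down-sets, open sets are the up-sets. The closure of $A\subseteq\mathcal{M}$ is the intersection of all closed sets containing $A$; $A$ is dense if its closure is $\mathcal{M}$. -}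

module Defs where

open import Data.Nat using (ℕ; zero; suc; _+_; _*_; _∸_; _<_)
open import Data.Fin using (Fin; _≟_)
open import Data.List using (List; []; _∷_)
open import Data.List.Relation.Unary.All using (All)
open import Data.List.Relation.Unary.Any using (Any)
open import Data.Product using (Σ; _×_; ∃; ∃-syntax)
open import Data.Sum using (_⊎_)
open import Function.Bundles using (_↔_; Inverse)
open import Function.Definitions using (Injective)
open import Relation.Binary.PropositionalEquality using (_≡_)
open import Relation.Nullary using (¬_; yes; no)
open import Level using (Level; suc) renaming (zero to lzero)

-- A raw quiver on vertex set Fin n: arr i j = number of arrows i → j.
RawQuiver : ℕ → Set
RawQuiver n = Fin n → Fin n → ℕ

record Quiver : Set where
  field
    n        : ℕ
    nonempty : 0 < n
    arr      : RawQuiver n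
    loopless : ∀ i → arr i i ≡ 0
    no2cycle : ∀ i j → arr i j ≡ 0 ⊎ arr j i ≡ 0
open Quiver public

-- For i, j ≠ k: after adding a_ik * a_kj arrows i → j
-- (and a_jk * a_ki arrows j → i) and cancelling a maximal set of 2-cycles,
-- the number of arrows i → j is (a_ij + a_ik a_kj) ∸ (a_ji + a_jk a_ki).
mutate : ∀ {n} → Fin n → RawQuiver n → RawQuiver n
mutate k a i j with i ≟ k | j ≟ k
... | yes _ | _     = a j i
... | no _  | yes _ = a j i
... | no _  | no _  = (a i j + a i k * a k j) ∸ (a j i + a j k * a k i)

mutateSeq : ∀ {n} → List (Fin n) → RawQuiver n → RawQuiver n
mutateSeq []       a = a
mutateSeq (k ∷ ks) a = mutateSeq ks (mutate k a)

RawIso : ∀ {m n} → RawQuiver m → RawQuiver n → Set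
RawIso {m} {n} a b =
  Σ (Fin m ↔ Fin n) λ σ → ∀ i j → b (Inverse.to σ i) (Inverse.to σ j) ≡ a i j

_~_ : Quiver → Quiver → Set
Q ~ Q' = Σ (List (Fin (n Q))) λ ks → RawIso (mutateSeq ks (arr Q)) (arr Q')

IsoToFullSub : Quiver → Quiver → Set
IsoToFullSub P Q =
  Σ (Fin (n P) → Fin (n Q)) λ f →
    Injective _≡_ _≡_ f × (∀ i j → arr Q (f i) (f j) ≡ arr P i j)

_⪯_ : Quiver → Quiver → Set
P ⪯ Q = ∃[ P' ] ∃[ Q' ] (P ~ P' × Q ~ Q' × IsoToFullSub P' Q')

-- Subsets of the set 𝓜 of mutation classes, represented as predicates on
-- quivers that are invariant under mutation equivalence.
IsClassSet : (Quiver → Set) → Set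
IsClassSet A = ∀ Q Q' → Q ~ Q' → A Q → A Q'

-- Closed sets of the mutation class topology: down-sets for ⪯.
IsClosed : (Quiver → Set) → Set
IsClosed C = IsClassSet C × (∀ P Q → P ⪯ Q → C Q → C P)

Closure : (Quiver → Set) → Quiver → Set₁
Closure A P = (C : Quiver → Set) → IsClosed C → (∀ Q → A Q → C Q) → C P

Dense : (Quiver → Set) → Set₁
Dense A = ∀ P → Closure A P

FiniteClassSet : (Quiver → Set) → Set
FiniteClassSet A =
  Σ (List Quiver) λ L → All A L × (∀ Q → A Q → Any (λ Q' → Q ~ Q') L)

InfiniteClassSet : (Quiver → Set) → Set
InfiniteClassSet A = ¬ FiniteClassSet A

{-# OPTIONS --safe #-}
-- The number of vertices is an invariant of mutation classes and is monotone
-- for ⪯, so the classes of quivers with at most N vertices form a closed set.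
-- A finite set of classes lies in such a set for N its largest vertex count,
-- hence its closure misses the class of any quiver with N + 1 vertices.
module Submission where

open import Defs
open import Data.Nat using (ℕ; suc; _≤_; _⊔_; s≤s; z≤n)
open import Data.Nat.Properties using (≤-trans; ≤-reflexive; m≤n⇒m≤n⊔o; m≤n⇒m≤o⊔n; 1+n≰n; module ≤-Reasoning)
open import Data.Fin using (Fin)
open import Data.Fin.Properties using (injective⇒≤; cantor-schröder-bernstein)
open import Data.List using (List; []; _∷_)
open import Data.List.Relation.Unary.Any using (Any; here; there)
open import Data.Product using (_,_; ∃-syntax; uncurry)
open import Data.Sum using (inj₁)
open import Function.Bundles using (_↔_; Injection)
open import Function.Properties.Inverse using (↔⇒↣; ↔-sym)
open import Relation.Binary.PropositionalEquality using (_≡_; refl; sym)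
open import Relation.Nullary using (¬_)

↔⇒≡ : ∀ {m k} → Fin m ↔ Fin k → m ≡ k
↔⇒≡ σ = cantor-schröder-bernstein (Injection.injective (↔⇒↣ σ))
                                   (Injection.injective (↔⇒↣ (↔-sym σ)))

~⇒n≡ : ∀ Q Q' → Q ~ Q' → n Q ≡ n Q'
~⇒n≡ _ _ (_ , σ , _) = ↔⇒≡ σ

⪯⇒n≤ : ∀ P Q → P ⪯ Q → n P ≤ n Q
⪯⇒n≤ P Q (P' , Q' , P~P' , Q~Q' , f , f-injective , _) = begin
  n P   ≡⟨ ~⇒n≡ P P' P~P' ⟩
  n P'  ≤⟨ injective⇒≤ f-injective ⟩
  n Q'  ≡⟨ sym (~⇒n≡ Q Q' Q~Q') ⟩
  n Q   ∎
  where open ≤-Reasoning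

AtMostVertices : ℕ → Quiver → Set
AtMostVertices N Q = n Q ≤ N

atMostVertices-closed : ∀ N → IsClosed (AtMostVertices N)
atMostVertices-closed N =
  (λ Q Q' Q~Q' Q≤N → ≤-trans (≤-reflexive (sym (~⇒n≡ Q Q' Q~Q'))) Q≤N) ,
  (λ P Q P⪯Q Q≤N → ≤-trans (⪯⇒n≤ P Q P⪯Q) Q≤N)

arrowlessQuiver : ℕ → Quiver
arrowlessQuiver N = record
  { n        = suc N
  ; nonempty = s≤s z≤n
  ; arr      = λ _ _ → 0
  ; loopless = λ _ → refl
  ; no2cycle = λ _ _ → inj₁ refl
  }

dense⇒unbounded : ∀ {A} → Dense A → ∀ N → ¬ (∀ Q → A Q → AtMostVertices N Q)
dense⇒unbounded dense N bounded =
  1+n≰n (dense (arrowlessQuiver N) (AtMostVertices N) (atMostVertices-closed N) bounded)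

maxVertices : List Quiver → ℕ
maxVertices []      = 0
maxVertices (Q ∷ L) = n Q ⊔ maxVertices L

any~⇒n≤maxVertices : ∀ Q L → Any (Q ~_) L → n Q ≤ maxVertices L
any~⇒n≤maxVertices Q (Q' ∷ L) (here Q~Q') = m≤n⇒m≤n⊔o (maxVertices L) (≤-reflexive (~⇒n≡ Q Q' Q~Q'))
any~⇒n≤maxVertices Q (Q' ∷ L) (there Q∈L) = m≤n⇒m≤o⊔n (n Q') (any~⇒n≤maxVertices Q L Q∈L)

finite⇒bounded : ∀ {A} → FiniteClassSet A → ∃[ N ] ∀ Q → A Q → AtMostVertices N Q
finite⇒bounded (L , _ , covers) = maxVertices L , λ Q AQ → any~⇒n≤maxVertices Q L (covers Q AQ)

corollary3p9 : (A : Quiver → Set) → IsClassSet A → Dense A → InfiniteClassSet A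
corollary3p9 A _ dense finite = uncurry (dense⇒unbounded dense) (finite⇒bounded finite)
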